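{- The operators $D$ and $D^-$ on functions of partitions do not commute, and satisfy $DD^- - D^-D = D$; that is, $D(D^-g)(\lambda)-D^-(Dg)(\lambda)=Dg(\lambda)$ for every function $g$ of partitions and every partition $\lambda$.
   Context: For a real-valued function $g$ on partitions, $Dg(\lambda)=\sum_{\lambda^+}g(\lambda^+)-g(\lambda)$ and $D^-g(\lambda)=|\lambda|\,g(\lambda)-\sum_{\lambda^- }g(\lambda^-)$, where $\lambda^+$ (resp. $\lambda^-$) ranges over all partitions obtained from $\lambda$ by adding (resp. removing) one box. -}

module Defs where

open import Level using (Level)
open import Data.Bool using (Bool; true; false; T; _∧_; if_then_else_)
open import Data.Bool.Properties using (T?)
open import Data.Nat using (ℕ; zero; suc; pred; _≤ᵇ_)
open import Data.List using (List; []; _∷_; length; map; upTo; mapMaybe; filter; foldr)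
open import Data.Nat.ListAction using (sum)
open import Data.Maybe using (Maybe; just; nothing)
open import Data.Product using (Σ; _,_; proj₁)
open import Relation.Nullary using (yes; no; ¬?)
open import Data.Nat.Properties using (_≟_)
open import Algebra.Bundles using (CommutativeRing)

nonincr : List ℕ → Bool
nonincr [] = true
nonincr (x ∷ []) = true
nonincr (x ∷ y ∷ xs) = (y ≤ᵇ x) ∧ nonincr (y ∷ xs)

allPos : List ℕ → Bool
allPos [] = true
allPos (zero ∷ xs) = false
allPos (suc _ ∷ xs) = allPos xs

isPart : List ℕ → Bool
isPart μ = nonincr μ ∧ allPos μ

Partition : Set
Partition = Σ (List ℕ) (λ μ → T (isPart μ))

size : Partition → ℕ
size λ′ = sum (proj₁ λ′)

mkPart : List ℕ → Maybe Partition
mkPart μ with T? (isPart μ)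
... | yes p = just (μ , p)
... | no _  = nothing

-- add one box to row i (row = length μ means a new row of length 1)
incAt : ℕ → List ℕ → List ℕ
incAt zero [] = 1 ∷ []
incAt zero (x ∷ xs) = suc x ∷ xs
incAt (suc i) [] = []
incAt (suc i) (x ∷ xs) = x ∷ incAt i xs

decAt : ℕ → List ℕ → List ℕ
decAt zero [] = []
decAt zero (x ∷ xs) = pred x ∷ xs
decAt (suc i) [] = []
decAt (suc i) (x ∷ xs) = x ∷ decAt i xs

addBox : Partition → List Partition
addBox (μ , _) = mapMaybe mkPart (map (λ i → incAt i μ) (upTo (suc (length μ))))

-- all partitions λ⁻ obtained by removing one box (each listed once):
-- the result of decrementing row i must still be weakly decreasing
-- (a trailing zero, if produced, is dropped)
removeBox : Partition → List Partition
removeBox (μ , _) =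
  mapMaybe (λ c → if nonincr c then mkPart (filter (λ x → ¬? (x ≟ 0)) c) else nothing)
           (map (λ i → decAt i μ) (upTo (length μ)))

module Ops {c ℓ : Level} (R : CommutativeRing c ℓ) where
  open CommutativeRing R

  sumR : List Carrier → Carrier
  sumR = foldr _+_ 0#

  ℕ→R : ℕ → Carrier
  ℕ→R zero = 0#
  ℕ→R (suc n) = 1# + ℕ→R n

  D : (Partition → Carrier) → Partition → Carrier
  D g λ′ = sumR (map g (addBox λ′)) - g λ′

  D⁻ : (Partition → Carrier) → Partition → Carrier
  D⁻ g λ′ = ℕ→R (size λ′) * g λ′ - sumR (map g (removeBox λ′))

module Submission where

-- Expanding both composites, the terms containing |λ| cancel because adding a
-- box raises the size by exactly one, and what remains is
--   D D⁻ g (λ) − D⁻ D g (λ) = Σ_{λ⁺} g(λ⁺) − UD(λ) + DU(λ),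
-- where UD sums g over the paths "add a box, then remove one" starting at λ
-- and DU over the paths "remove a box, then add one".  A partition μ ≠ λ is
-- the end of equally many paths of either kind, while λ itself is reached once
-- per addable corner by UD and once per removable corner by DU; as there is
-- one more addable than removable corner, UD = DU + g(λ), so the commutator
-- is Σ g(λ⁺) − g(λ) = D g(λ).

open import Defs
open import Level using (Level)
open import Data.Product using (_×_; ∃)
open import Relation.Nullary using (¬_)
open import Algebra.Bundles using (CommutativeRing)

open import Data.Bool using (Bool; true; false; T; _∧_; if_then_else_)
open import Data.Bool.Properties using (T?; T-≡; T-irrelevant; ∧-identityʳ; ∧-conicalˡ; ∧-conicalʳ)
open import Data.Nat using (ℕ; zero; suc; pred; _≤ᵇ_; _<ᵇ_; _≤_; _<_; z≤n)
import Data.Nat as ℕ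
open import Data.Nat.Properties using (_≟_; ≤ᵇ⇒≤; ≤⇒≤ᵇ; ≤-trans; n≤1+n; ≰⇒>; <⇒≱; pred[n]≤n)
open import Data.Nat.ListAction using (sum)
open import Data.List using (List; []; _∷_; length; map; upTo; applyUpTo; filter; catMaybes; mapMaybe)
open import Data.List.Properties using (map-upTo; map-applyUpTo)
open import Data.Maybe using (Maybe; just; nothing; maybe′)
open import Data.Product using (_,_; proj₁)
open import Function using (Equivalence)
open import Relation.Nullary using (yes; no; ¬?; contradiction)
open import Relation.Binary.PropositionalEquality
  using (_≡_; cong) renaming (refl to ≡-refl; sym to ≡-sym; trans to ≡-trans)

fits : Maybe ℕ → ℕ → Bool
fits nothing  _ = true
fits (just b) y = y ≤ᵇ b

-- ν is weakly decreasing and its first part fits under the cap m.  The cap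
-- lets the tail of a list be treated as a list capped by its first part.
capped : Maybe ℕ → List ℕ → Bool
capped m []       = true
capped m (y ∷ ys) = fits m y ∧ capped (just y) ys

-- Removing the last box of a row leaves a zero part; `removeBox` discards it.
dropZeros : List ℕ → List ℕ
dropZeros = filter (λ x → ¬? (x ≟ 0))

head₀ : List ℕ → ℕ
head₀ []      = 0
head₀ (y ∷ _) = y

≤ᵇ-true : ∀ {m n} → m ≤ n → (m ≤ᵇ n) ≡ true
≤ᵇ-true m≤n = Equivalence.to T-≡ (≤⇒≤ᵇ m≤n)

≤ᵇ-sound : ∀ {m n} → (m ≤ᵇ n) ≡ true → m ≤ n
≤ᵇ-sound {m} {n} e = ≤ᵇ⇒≤ m n (Equivalence.from T-≡ e)

≤ᵇ-false : ∀ {m n} → ¬ (m ≤ n) → (m ≤ᵇ n) ≡ false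
≤ᵇ-false {m} {n} m≰n with m ≤ᵇ n in eq
... | true  = contradiction (≤ᵇ-sound eq) m≰n
... | false = ≡-refl

¬T⇒≡false : ∀ {b} → ¬ T b → b ≡ false
¬T⇒≡false {true}  ¬t = contradiction _ ¬t
¬T⇒≡false {false} _  = ≡-refl

bool-cases : ∀ {ℓ} (a : Bool) {X : Set ℓ} → (a ≡ true → X) → (a ≡ false → X) → X
bool-cases true  t f = t ≡-refl
bool-cases false t f = f ≡-refl

fits-mono : ∀ m {y z} → y ≤ z → fits m z ≡ true → fits m y ≡ true
fits-mono nothing  _   _ = ≡-refl
fits-mono (just b) y≤z e = ≤ᵇ-true (≤-trans y≤z (≤ᵇ-sound e))

capped-mono : ∀ {c c′} xs → c ≤ c′ → capped (just c) xs ≡ true → capped (just c′) xs ≡ true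
capped-mono []       _    _ = ≡-refl
capped-mono {c} {c′} (y ∷ ys) c≤c′ e
  rewrite ≤ᵇ-true {y} {c′} (≤-trans (≤ᵇ-sound (∧-conicalˡ (y ≤ᵇ c) _ e)) c≤c′) = ∧-conicalʳ (y ≤ᵇ c) _ e

nonincr≡capped : ∀ ν → nonincr ν ≡ capped nothing ν
nonincr≡capped []       = ≡-refl
nonincr≡capped (x ∷ xs) = cons x xs
  where
  cons : ∀ x xs → nonincr (x ∷ xs) ≡ capped (just x) xs
  cons x []       = ≡-refl
  cons x (y ∷ ys) = cong ((y ≤ᵇ x) ∧_) (cons y ys)

capped-pred : ∀ x′ xs → capped (just (suc x′)) xs ≡ true →
  capped (just x′) xs ≡ fits (just (suc x′)) (suc (head₀ xs))
capped-pred x′ []       _ = ≡-refl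
capped-pred x′ (y ∷ ys) e =
  ≡-trans (cong ((y ≤ᵇ x′) ∧_) (∧-conicalʳ (y ≤ᵇ suc x′) _ e)) (≡-trans (∧-identityʳ _) (≤ᵇ≡<ᵇ y))
  where
  ≤ᵇ≡<ᵇ : ∀ y → (y ≤ᵇ x′) ≡ (y <ᵇ suc x′)
  ≤ᵇ≡<ᵇ zero    = ≡-refl
  ≤ᵇ≡<ᵇ (suc y) = ≡-refl

capped0⇒dropZeros≡[] : ∀ ys → capped (just 0) ys ≡ true → dropZeros ys ≡ []
capped0⇒dropZeros≡[] []           _  = ≡-refl
capped0⇒dropZeros≡[] (zero ∷ zs)  e  = capped0⇒dropZeros≡[] zs e
capped0⇒dropZeros≡[] (suc z ∷ zs) ()

capped-dropZeros : ∀ m ν → capped m ν ≡ true → capped m (dropZeros ν) ≡ true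
capped-dropZeros m []           _ = ≡-refl
capped-dropZeros m (zero ∷ ys)  e rewrite capped0⇒dropZeros≡[] ys (∧-conicalʳ (fits m 0) _ e) = ≡-refl
capped-dropZeros m (suc y ∷ ys) e rewrite ∧-conicalˡ (fits m (suc y)) _ e =
  capped-dropZeros (just (suc y)) ys (∧-conicalʳ (fits m (suc y)) _ e)

allPos-dropZeros : ∀ ν → allPos (dropZeros ν) ≡ true
allPos-dropZeros []           = ≡-refl
allPos-dropZeros (zero ∷ ys)  = allPos-dropZeros ys
allPos-dropZeros (suc y ∷ ys) = allPos-dropZeros ys

dropZeros-allPos : ∀ ν → allPos ν ≡ true → dropZeros ν ≡ ν
dropZeros-allPos []           _  = ≡-refl
dropZeros-allPos (zero ∷ _)   ()
dropZeros-allPos (suc y ∷ ys) e  = cong (suc y ∷_) (dropZeros-allPos ys e)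

dropZeros-idem : ∀ ν → dropZeros (dropZeros ν) ≡ dropZeros ν
dropZeros-idem ν = dropZeros-allPos (dropZeros ν) (allPos-dropZeros ν)

isPart-dropZeros : ∀ ν → capped nothing ν ≡ true → T (isPart (dropZeros ν))
isPart-dropZeros ν e
  rewrite nonincr≡capped (dropZeros ν) | capped-dropZeros nothing ν e | allPos-dropZeros ν = _

isPart≡capped : ∀ ν → allPos ν ≡ true → isPart ν ≡ capped nothing ν
isPart≡capped ν e rewrite e = ≡-trans (∧-identityʳ (nonincr ν)) (nonincr≡capped ν)

isPart⇒capped : ∀ ν → T (isPart ν) → capped nothing ν ≡ true
isPart⇒capped ν p = ≡-trans (≡-sym (nonincr≡capped ν)) (∧-conicalˡ (nonincr ν) _ (Equivalence.to T-≡ p))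

isPart⇒allPos : ∀ ν → T (isPart ν) → allPos ν ≡ true
isPart⇒allPos ν p = ∧-conicalʳ (nonincr ν) _ (Equivalence.to T-≡ p)

mkPart-partition : ∀ (π : Partition) → mkPart (proj₁ π) ≡ just π
mkPart-partition (μ , p) with T? (isPart μ)
... | yes p′ = cong (λ q → just (μ , q)) (T-irrelevant p′ p)
... | no ¬p  = contradiction p ¬p

mkPart-elim : ∀ {ℓ} ν (Q : Maybe Partition → Set ℓ) →
  (∀ p → Q (just (ν , p))) → (isPart ν ≡ false → Q nothing) → Q (mkPart ν)
mkPart-elim ν Q onPart onOther with T? (isPart ν)
... | yes p  = onPart p
... | no ¬p  = onOther (¬T⇒≡false ¬p)

module RowSums {c ℓ : Level} (R : CommutativeRing c ℓ) where
  open CommutativeRing R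
  open Ops R using (ℕ→R)
  open import Algebra.Properties.AbelianGroup +-abelianGroup using (⁻¹-∙-comm)
  open import Algebra.Properties.Group +-group using (⁻¹-involutive)
  open import Algebra.Properties.Ring ring using (x[y-z]≈xy-xz)
  open import Algebra.Properties.CommutativeSemigroup +-commutativeSemigroup using (interchange)
  import Algebra.Solver.CommutativeMonoid +-commutativeMonoid as +-Solver
  open +-Solver using (solve; _⊜_; _⊕_) renaming (id to ∅)
  open import Relation.Binary.Reasoning.Setoid setoid

  minus-interchange : ∀ a b c d → (a - b) + (c - d) ≈ (a + c) - (b + d)
  minus-interchange a b c d = trans (interchange a (- b) c (- d)) (+-congˡ (⁻¹-∙-comm b d))

  -- The ring identity that combines the expansions of D D⁻ and D⁻ D.
  commutator-algebra : ∀ n A du g r →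
    (((1# + n) * A - (du + g)) - (n * g - r)) - (n * (A - g) - (du - r)) ≈ A - g
  commutator-algebra n A du g r = begin
      X - Y
    ≈⟨ +-congʳ X≈ ⟩
      ((A - g) + Y) - Y
    ≈⟨ +-assoc _ _ _ ⟩
      (A - g) + (Y - Y)
    ≈⟨ +-congˡ (-‿inverseʳ Y) ⟩
      (A - g) + 0#
    ≈⟨ +-identityʳ _ ⟩
      A - g ∎
    where
    X Y : Carrier
    X = ((1# + n) * A - (du + g)) - (n * g - r)
    Y = n * (A - g) - (du - r)
    neg-+ : ∀ a b → - (a + b) ≈ - a + - b
    neg-+ a b = sym (⁻¹-∙-comm a b)
    neg-- : ∀ a b → - (a - b) ≈ - a + b
    neg-- a b = trans (neg-+ a (- b)) (+-congˡ (⁻¹-involutive b))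
    X≈ : X ≈ (A - g) + Y
    X≈ = begin
        X
      ≈⟨ +-cong (+-cong (trans (distribʳ A 1# n) (+-congʳ (*-identityˡ A))) (neg-+ du g)) (neg-- (n * g) r) ⟩
        ((A + n * A) + (- du + - g)) + (- (n * g) + r)
      ≈⟨ solve 6 (λ a b c d e f → ((a ⊕ b) ⊕ (c ⊕ d)) ⊕ (e ⊕ f) ⊜ (a ⊕ d) ⊕ ((b ⊕ e) ⊕ (c ⊕ f))) refl
                 A (n * A) (- du) (- g) (- (n * g)) r ⟩
        (A + - g) + ((n * A + - (n * g)) + (- du + r))
      ≈⟨ +-congˡ (sym (+-cong (x[y-z]≈xy-xz n A g) (neg-- du r))) ⟩
        (A - g) + Y ∎

  when : Bool → Carrier → Carrier
  when true  r = r
  when false r = 0#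

  when-cong : ∀ b {r s} → r ≈ s → when b r ≈ when b s
  when-cong true  e = e
  when-cong false e = refl

  when-0 : ∀ b → when b 0# ≈ 0#
  when-0 true  = refl
  when-0 false = refl

  when-+ : ∀ b r s → when b (r + s) ≈ when b r + when b s
  when-+ true  r s = refl
  when-+ false r s = sym (+-identityʳ 0#)

  when-T : ∀ {b} r → b ≡ true → when b r ≈ r
  when-T r ≡-refl = refl

  when-F : ∀ {b} r → b ≡ false → when b r ≈ 0#
  when-F r ≡-refl = refl

  when-∧T : ∀ {a} b r → a ≡ true → when (a ∧ b) r ≡ when b r
  when-∧T b r ≡-refl = ≡-refl

  when-∧F : ∀ {a} b r → a ≡ false → when (a ∧ b) r ≡ 0#
  when-∧F b r ≡-refl = ≡-refl

  when-nest : ∀ b c r → (b ≡ true → c ≡ true) → when b (when c r) ≈ when b r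
  when-nest true  c r b⇒c = when-T r (b⇒c ≡-refl)
  when-nest false c r b⇒c = refl

  when-nest′ : ∀ b c r → (c ≡ true → b ≡ true) → when b (when c r) ≈ when c r
  when-nest′ b false r c⇒b = when-0 b
  when-nest′ b true  r c⇒b rewrite c⇒b ≡-refl = refl

  -- No validity test is made here: the
  -- summands decide themselves, through `when`, which results count.
  Σ⁺ : (List ℕ → Carrier) → List ℕ → Carrier
  Σ⁺ F []       = F (1 ∷ [])
  Σ⁺ F (x ∷ xs) = F (suc x ∷ xs) + Σ⁺ (λ ν → F (x ∷ ν)) xs

  Σ⁻ : (List ℕ → Carrier) → List ℕ → Carrier
  Σ⁻ F []       = 0#
  Σ⁻ F (x ∷ xs) = F (pred x ∷ xs) + Σ⁻ (λ ν → F (x ∷ ν)) xs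

  Σ⁺-cong : ∀ {F G} μ → (∀ ν → F ν ≈ G ν) → Σ⁺ F μ ≈ Σ⁺ G μ
  Σ⁺-cong []       h = h _
  Σ⁺-cong (x ∷ xs) h = +-cong (h _) (Σ⁺-cong xs (λ ν → h (x ∷ ν)))

  Σ⁻-cong : ∀ {F G} μ → (∀ ν → F ν ≈ G ν) → Σ⁻ F μ ≈ Σ⁻ G μ
  Σ⁻-cong []       h = refl
  Σ⁻-cong (x ∷ xs) h = +-cong (h _) (Σ⁻-cong xs (λ ν → h (x ∷ ν)))

  -- Adding a box to a list of positive parts only produces such lists.
  Σ⁺-congPos : ∀ {F G} μ → allPos μ ≡ true →
    (∀ ν → allPos ν ≡ true → F ν ≈ G ν) → Σ⁺ F μ ≈ Σ⁺ G μ
  Σ⁺-congPos []           _  h = h (1 ∷ []) ≡-refl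
  Σ⁺-congPos (zero ∷ xs)  () h
  Σ⁺-congPos (suc x ∷ xs) e  h = +-cong (h (suc (suc x) ∷ xs) e) (Σ⁺-congPos xs e (λ ν e′ → h (suc x ∷ ν) e′))

  Σ⁺-zero : ∀ {F} μ → (∀ ν → F ν ≈ 0#) → Σ⁺ F μ ≈ 0#
  Σ⁺-zero []       h = h _
  Σ⁺-zero (x ∷ xs) h = trans (+-cong (h _) (Σ⁺-zero xs (λ ν → h (x ∷ ν)))) (+-identityʳ 0#)

  Σ⁻-zero : ∀ {F} μ → (∀ ν → F ν ≈ 0#) → Σ⁻ F μ ≈ 0#
  Σ⁻-zero []       h = refl
  Σ⁻-zero (x ∷ xs) h = trans (+-cong (h _) (Σ⁻-zero xs (λ ν → h (x ∷ ν)))) (+-identityʳ 0#)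

  Σ⁺-+ : ∀ F G μ → Σ⁺ (λ ν → F ν + G ν) μ ≈ Σ⁺ F μ + Σ⁺ G μ
  Σ⁺-+ F G []       = refl
  Σ⁺-+ F G (x ∷ xs) = trans (+-congˡ (Σ⁺-+ (λ ν → F (x ∷ ν)) (λ ν → G (x ∷ ν)) xs)) (interchange _ _ _ _)

  Σ⁻-+ : ∀ F G μ → Σ⁻ (λ ν → F ν + G ν) μ ≈ Σ⁻ F μ + Σ⁻ G μ
  Σ⁻-+ F G []       = sym (+-identityʳ 0#)
  Σ⁻-+ F G (x ∷ xs) = trans (+-congˡ (Σ⁻-+ (λ ν → F (x ∷ ν)) (λ ν → G (x ∷ ν)) xs)) (interchange _ _ _ _)

  Σ⁺-- : ∀ F G μ → Σ⁺ (λ ν → F ν - G ν) μ ≈ Σ⁺ F μ - Σ⁺ G μ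
  Σ⁺-- F G []       = refl
  Σ⁺-- F G (x ∷ xs) = trans (+-congˡ (Σ⁺-- (λ ν → F (x ∷ ν)) (λ ν → G (x ∷ ν)) xs)) (minus-interchange _ _ _ _)

  Σ⁻-- : ∀ F G μ → Σ⁻ (λ ν → F ν - G ν) μ ≈ Σ⁻ F μ - Σ⁻ G μ
  Σ⁻-- F G []       = sym (-‿inverseʳ 0#)
  Σ⁻-- F G (x ∷ xs) = trans (+-congˡ (Σ⁻-- (λ ν → F (x ∷ ν)) (λ ν → G (x ∷ ν)) xs)) (minus-interchange _ _ _ _)

  ℕ→R-+ : ∀ a b → ℕ→R (a ℕ.+ b) ≈ ℕ→R a + ℕ→R b
  ℕ→R-+ zero    b = sym (+-identityˡ _)
  ℕ→R-+ (suc a) b = trans (+-congˡ (ℕ→R-+ a b)) (sym (+-assoc _ _ _))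

  -- Every list in Σ⁺ F μ has one box more than μ, so weighting the summands
  -- by their size (shifted by k) multiplies the whole sum by |μ| + 1 (+ k).
  Σ⁺-sizeWeighted : ∀ k F μ →
    Σ⁺ (λ ν → (k + ℕ→R (sum ν)) * F ν) μ ≈ (k + ℕ→R (suc (sum μ))) * Σ⁺ F μ
  Σ⁺-sizeWeighted k F []       = refl
  Σ⁺-sizeWeighted k F (x ∷ xs) = begin
      (k + ℕ→R (suc x ℕ.+ s)) * F (suc x ∷ xs) + Σ⁺ (λ ν → (k + ℕ→R (x ℕ.+ sum ν)) * F (x ∷ ν)) xs
    ≈⟨ +-congˡ (Σ⁺-cong xs (λ ν → *-congʳ (shift (sum ν)))) ⟩
      (k + ℕ→R (suc x ℕ.+ s)) * F (suc x ∷ xs) + Σ⁺ (λ ν → ((k + ℕ→R x) + ℕ→R (sum ν)) * F (x ∷ ν)) xs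
    ≈⟨ +-congˡ (Σ⁺-sizeWeighted (k + ℕ→R x) (λ ν → F (x ∷ ν)) xs) ⟩
      (k + ℕ→R (suc x ℕ.+ s)) * F (suc x ∷ xs) + ((k + ℕ→R x) + ℕ→R (suc s)) * Σ⁺ (λ ν → F (x ∷ ν)) xs
    ≈⟨ +-congˡ (*-congʳ sameWeight) ⟩
      (k + ℕ→R (suc x ℕ.+ s)) * F (suc x ∷ xs) + (k + ℕ→R (suc x ℕ.+ s)) * Σ⁺ (λ ν → F (x ∷ ν)) xs
    ≈⟨ sym (distribˡ _ _ _) ⟩
      (k + ℕ→R (suc (x ℕ.+ s))) * Σ⁺ F (x ∷ xs) ∎
    where
    s : ℕ
    s = sum xs
    shift : ∀ t → k + ℕ→R (x ℕ.+ t) ≈ (k + ℕ→R x) + ℕ→R t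
    shift t = trans (+-congˡ (ℕ→R-+ x t)) (sym (+-assoc _ _ _))
    sameWeight : (k + ℕ→R x) + ℕ→R (suc s) ≈ k + ℕ→R (suc x ℕ.+ s)
    sameWeight = begin
        (k + ℕ→R x) + (1# + ℕ→R s)
      ≈⟨ solve 4 (λ a b c o → (a ⊕ b) ⊕ (o ⊕ c) ⊜ a ⊕ (o ⊕ (b ⊕ c))) refl k (ℕ→R x) (ℕ→R s) 1# ⟩
        k + (1# + (ℕ→R x + ℕ→R s))
      ≈⟨ +-congˡ (+-congˡ (sym (ℕ→R-+ x s))) ⟩
        k + ℕ→R (suc x ℕ.+ s) ∎

  restrict : Maybe ℕ → (List ℕ → Carrier) → List ℕ → Carrier
  restrict m K ρ = when (capped m ρ) (K ρ)

  -- Sums of K over the two-step paths "add a box, then remove one" and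
  -- "remove a box, then add one", each step staying among capped lists.
  upDown : Maybe ℕ → (List ℕ → Carrier) → List ℕ → Carrier
  upDown m K μ = Σ⁺ (λ ν → when (capped m ν) (Σ⁻ (restrict m K) ν)) μ

  downUp : Maybe ℕ → (List ℕ → Carrier) → List ℕ → Carrier
  downUp m K μ = Σ⁻ (λ ν → when (capped m ν) (Σ⁺ (restrict m K) ν)) μ

  -- K does not see zero parts, i.e. it is a function of partitions.
  ZeroBlind : (List ℕ → Carrier) → Set ℓ
  ZeroBlind K = ∀ ρ → K (dropZeros ρ) ≈ K ρ

  Σ⁻-capSuc : ∀ b (f : List ℕ → Carrier) xs → capped (just b) xs ≡ true →
    Σ⁻ (λ ρ → when (capped (just (suc b)) ρ) (f ρ)) xs ≈ Σ⁻ (λ ρ → when (capped (just b) ρ) (f ρ)) xs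
  Σ⁻-capSuc b f []       _ = refl
  Σ⁻-capSuc b f (y ∷ ys) e =
    +-cong (reflexive (tighten (capped (just (pred y)) ys) (≤-trans pred[n]≤n y≤b)))
           (Σ⁻-cong ys (λ σ → reflexive (tighten (capped (just y) σ) y≤b)))
    where
    y≤b : y ≤ b
    y≤b = ≤ᵇ-sound (∧-conicalˡ (y ≤ᵇ b) _ e)
    tighten : ∀ {z r} t → z ≤ b → when ((z ≤ᵇ suc b) ∧ t) r ≡ when ((z ≤ᵇ b) ∧ t) r
    tighten t z≤b = ≡-trans (when-∧T t _ (≤ᵇ-true (≤-trans z≤b (n≤1+n b)))) (≡-sym (when-∧T t _ (≤ᵇ-true z≤b)))

  Σ⁺-overCap : ∀ b y ys (f : List ℕ → Carrier) → b < y →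
    Σ⁺ (λ ρ → when (capped (just b) ρ) (f ρ)) (y ∷ ys) ≈ 0#
  Σ⁺-overCap b y ys f b<y =
    trans (+-cong (reflexive (when-∧F (capped (just (suc y)) ys) _ (≤ᵇ-false (λ sy≤b → <⇒≱ b<y (≤-trans (n≤1+n y) sy≤b)))))
                  (Σ⁺-zero ys (λ σ → reflexive (when-∧F (capped (just y) σ) _ (≤ᵇ-false (<⇒≱ b<y))))))
          (+-identityʳ 0#)

  -- A list capped by x′ + 1 but not by x′ starts with x′ + 1, so additions
  -- under the cap x′ all vanish.
  Σ⁺-tightCap : ∀ x′ xs (f : List ℕ → Carrier) →
    capped (just (suc x′)) xs ≡ true → capped (just x′) xs ≡ false →
    Σ⁺ (λ ν → when (capped (just x′) ν) (f ν)) xs ≈ 0#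
  Σ⁺-tightCap x′ []       f _      ()
  Σ⁺-tightCap x′ (y ∷ ys) f capSuc ¬cap = Σ⁺-overCap x′ y ys f (≰⇒> y≰x′)
    where
    y≰x′ : ¬ (y ≤ x′)
    y≰x′ y≤x′ with ≡-trans (≡-sym ¬cap)
                    (≡-trans (cong (_∧ capped (just y) ys) (≤ᵇ-true y≤x′)) (∧-conicalʳ (y ≤ᵇ suc x′) _ capSuc))
    ... | ()

  -- Adding a box always creates a positive part, which is not capped by 0.
  Σ⁺-cap0 : ∀ a (f : List ℕ → Carrier) xs → Σ⁺ (λ σ → when (a ∧ capped (just 0) σ) (f σ)) xs ≈ 0#
  Σ⁺-cap0 false f xs = Σ⁺-zero xs (λ _ → refl)
  Σ⁺-cap0 true  f xs = go f xs
    where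
    go : ∀ (f : List ℕ → Carrier) xs → Σ⁺ (λ σ → when (capped (just 0) σ) (f σ)) xs ≈ 0#
    go f []           = refl
    go f (zero ∷ ys)  = trans (+-identityˡ _) (go (λ σ → f (0 ∷ σ)) ys)
    go f (suc y ∷ ys) = trans (+-identityˡ _) (Σ⁺-zero ys (λ σ → refl))

  -- Trailing zero rows do not change the capped additions: adding to the first
  -- zero row is the same as starting a new row, and adding to a later zero row
  -- breaks monotonicity.
  Σ⁺-dropZeros : ∀ m K ν → ZeroBlind K → capped m ν ≡ true →
    Σ⁺ (restrict m K) ν ≈ Σ⁺ (restrict m K) (dropZeros ν)
  Σ⁺-dropZeros m K []           blind e = refl
  Σ⁺-dropZeros m K (zero ∷ xs)  blind e = begin
      when (fits m 1 ∧ capped (just 1) xs) (K (1 ∷ xs)) + Σ⁺ (λ σ → when (fits m 0 ∧ capped (just 0) σ) (K (0 ∷ σ))) xs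
    ≈⟨ +-cong (reflexive (cong (λ b → when (fits m 1 ∧ b) (K (1 ∷ xs))) cap1)) (Σ⁺-cap0 (fits m 0) (λ σ → K (0 ∷ σ)) xs) ⟩
      when (fits m 1 ∧ true) (K (1 ∷ xs)) + 0#
    ≈⟨ +-identityʳ _ ⟩
      when (fits m 1 ∧ true) (K (1 ∷ xs))
    ≈⟨ when-cong (fits m 1 ∧ true) (trans (sym (blind (1 ∷ xs))) (reflexive (cong (λ l → K (1 ∷ l)) zeros))) ⟩
      when (fits m 1 ∧ true) (K (1 ∷ []))
    ≈⟨ reflexive (cong (Σ⁺ (restrict m K)) (≡-sym zeros)) ⟩
      Σ⁺ (restrict m K) (dropZeros xs) ∎
    where
    cap0 : capped (just 0) xs ≡ true
    cap0 = ∧-conicalʳ (fits m 0) _ e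
    cap1 : capped (just 1) xs ≡ true
    cap1 = capped-mono xs z≤n cap0
    zeros : dropZeros xs ≡ []
    zeros = capped0⇒dropZeros≡[] xs cap0
  Σ⁺-dropZeros m K (suc x ∷ xs) blind e = +-cong first rest
    where
    fitsx : fits m (suc x) ≡ true
    fitsx = ∧-conicalˡ (fits m (suc x)) _ e
    capx : capped (just (suc x)) xs ≡ true
    capx = ∧-conicalʳ (fits m (suc x)) _ e
    capSuc : capped (just (suc (suc x))) xs ≡ true
    capSuc = capped-mono xs (n≤1+n (suc x)) capx
    first : when (fits m (suc (suc x)) ∧ capped (just (suc (suc x))) xs) (K (suc (suc x) ∷ xs))
          ≈ when (fits m (suc (suc x)) ∧ capped (just (suc (suc x))) (dropZeros xs)) (K (suc (suc x) ∷ dropZeros xs))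
    first = trans (reflexive (cong (λ b → when (fits m (suc (suc x)) ∧ b) (K (suc (suc x) ∷ xs))) capSuc))
            (trans (when-cong (fits m (suc (suc x)) ∧ true) (sym (blind (suc (suc x) ∷ xs))))
                   (reflexive (cong (λ b → when (fits m (suc (suc x)) ∧ b) (K (suc (suc x) ∷ dropZeros xs)))
                                    (≡-sym (capped-dropZeros (just (suc (suc x))) xs capSuc)))))
    underFits : ∀ σ → when (fits m (suc x) ∧ capped (just (suc x)) σ) (K (suc x ∷ σ))
                    ≡ restrict (just (suc x)) (λ ρ → K (suc x ∷ ρ)) σ
    underFits σ = when-∧T (capped (just (suc x)) σ) _ fitsx
    rest : Σ⁺ (λ σ → when (fits m (suc x) ∧ capped (just (suc x)) σ) (K (suc x ∷ σ))) xs
         ≈ Σ⁺ (λ σ → when (fits m (suc x) ∧ capped (just (suc x)) σ) (K (suc x ∷ σ))) (dropZeros xs)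
    rest = trans (Σ⁺-cong xs (λ σ → reflexive (underFits σ)))
           (trans (Σ⁺-dropZeros (just (suc x)) (λ ρ → K (suc x ∷ ρ)) xs (λ ρ → blind (suc x ∷ ρ)) capx)
                  (Σ⁺-cong (dropZeros xs) (λ σ → reflexive (≡-sym (underFits σ)))))

  -- The two-step paths out of a list μ = x ∷ xs with positive first row
  -- x = x′ + 1, sorted by the rows they touch.  Paths that stay below the
  -- first row form upDown/downUp of the tail xs (capped by x); the others
  -- are named here.
  module FirstRow (m : Maybe ℕ) (K : List ℕ → Carrier) (x′ : ℕ) (xs : List ℕ)
                  (cap : capped m (suc x′ ∷ xs) ≡ true) where
    x : ℕ
    x = suc x′
    μ : List ℕ
    μ = x ∷ xs
    H : List ℕ → Carrier
    H = restrict m K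
    tailK : List ℕ → Carrier
    tailK ρ = K (x ∷ ρ)

    fitsx : fits m x ≡ true
    fitsx = ∧-conicalˡ (fits m x) _ cap
    fitsx′ : fits m x′ ≡ true
    fitsx′ = fits-mono m (n≤1+n x′) fitsx
    capTail : capped (just x) xs ≡ true
    capTail = ∧-conicalʳ (fits m x) _ cap
    capTailSuc : capped (just (suc x)) xs ≡ true
    capTailSuc = capped-mono xs (n≤1+n x) capTail

    -- The first row can be shortened iff the second row is at most x′.
    shortenable : Bool
    shortenable = capped (just x′) xs
    -- Paths returning to μ through the first row, and through the tail's first row.
    cornerUp cornerTail : Carrier
    cornerUp = when (fits m (suc x)) (K μ)
    cornerTail = when (fits (just x) (suc (head₀ xs))) (K μ)
    -- Add in the first row and remove below it (or in the other order).
    firstUp-lowerDown : Carrier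
    firstUp-lowerDown = Σ⁻ (λ ρ → when (capped m (x ∷ ρ)) (H (suc x ∷ ρ))) xs
    -- Add below the first row and remove from it (or in the other order).
    lowerUp-firstDown : Carrier
    lowerUp-firstDown = Σ⁺ (λ ν → when (capped (just x′) ν) (K (x′ ∷ ν))) xs

    cornerTail≡shortenable : shortenable ≡ fits (just x) (suc (head₀ xs))
    cornerTail≡shortenable = capped-pred x′ xs capTail

    -- Below the first row, the cap m is automatically met.
    belowFirst : ∀ ν r → when (capped m (x ∷ ν)) r ≡ when (capped (just x) ν) r
    belowFirst ν r = when-∧T (capped (just x) ν) r fitsx

    upFirst : when (capped m (suc x ∷ xs)) (Σ⁻ H (suc x ∷ xs)) ≈ cornerUp + firstUp-lowerDown
    upFirst = bool-cases (fits m (suc x))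
      (λ fitsSuc → trans (trans (reflexive (when-∧T (capped (just (suc x)) xs) _ fitsSuc)) (when-T _ capTailSuc))
        (+-cong (trans (when-T (K μ) cap) (sym (when-T (K μ) fitsSuc)))
          (trans (trans (Σ⁻-cong xs (λ ρ → reflexive (when-∧T (capped (just (suc x)) ρ) _ fitsSuc)))
                        (Σ⁻-capSuc x (λ ρ → K (suc x ∷ ρ)) xs capTail))
                 (sym (Σ⁻-cong xs (λ ρ → trans (reflexive (belowFirst ρ _))
                   (trans (when-cong (capped (just x) ρ) (reflexive (when-∧T (capped (just (suc x)) ρ) _ fitsSuc)))
                          (when-nest (capped (just x) ρ) (capped (just (suc x)) ρ) _ (capped-mono ρ (n≤1+n x))))))))))
      (λ ¬fitsSuc → trans (reflexive (when-∧F (capped (just (suc x)) xs) _ ¬fitsSuc))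
        (sym (trans (+-cong (when-F (K μ) ¬fitsSuc)
                            (Σ⁻-zero xs (λ ρ → trans (when-cong (capped m (x ∷ ρ))
                                                  (reflexive (when-∧F (capped (just (suc x)) ρ) _ ¬fitsSuc)))
                                                (when-0 (capped m (x ∷ ρ))))))
                    (+-identityʳ 0#))))

    upLower-downFirst : Σ⁺ (λ ν → when (capped m (x ∷ ν)) (H (x′ ∷ ν))) xs ≈ lowerUp-firstDown
    upLower-downFirst = Σ⁺-cong xs (λ ν → trans (reflexive (belowFirst ν _))
      (trans (when-cong (capped (just x) ν) (reflexive (when-∧T (capped (just x′) ν) _ fitsx′)))
             (when-nest′ (capped (just x) ν) (capped (just x′) ν) _ (capped-mono ν (n≤1+n x′)))))

    upLower-downLower : Σ⁺ (λ ν → when (capped m (x ∷ ν)) (Σ⁻ (λ ρ → H (x ∷ ρ)) ν)) xs ≈ upDown (just x) tailK xs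
    upLower-downLower = Σ⁺-cong xs (λ ν → trans (reflexive (belowFirst ν _))
      (when-cong (capped (just x) ν) (Σ⁻-cong ν (λ ρ → reflexive (belowFirst ρ _)))))

    downFirst : when (capped m (x′ ∷ xs)) (Σ⁺ H (x′ ∷ xs)) ≈ when shortenable (K μ + lowerUp-firstDown)
    downFirst = trans (reflexive (when-∧T shortenable _ fitsx′))
      (when-cong shortenable (+-cong (when-T (K μ) cap)
                                     (Σ⁺-cong xs (λ σ → reflexive (when-∧T (capped (just x′) σ) _ fitsx′)))))

    downLower-upLower : Σ⁻ (λ ρ → when (capped m (x ∷ ρ)) (Σ⁺ (λ σ → H (x ∷ σ)) ρ)) xs ≈ downUp (just x) tailK xs
    downLower-upLower = Σ⁻-cong xs (λ ρ → trans (reflexive (belowFirst ρ _))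
      (when-cong (capped (just x) ρ) (Σ⁺-cong ρ (λ σ → reflexive (belowFirst σ _)))))

    upDown-split : upDown m K μ ≈ (cornerUp + firstUp-lowerDown) + (lowerUp-firstDown + upDown (just x) tailK xs)
    upDown-split = +-cong upFirst
      (trans (Σ⁺-cong xs (λ ν → when-+ (capped m (x ∷ ν)) _ _))
             (trans (Σ⁺-+ _ _ xs) (+-cong upLower-downFirst upLower-downLower)))

    downUp-split : downUp m K μ ≈ when shortenable (K μ + lowerUp-firstDown) + (firstUp-lowerDown + downUp (just x) tailK xs)
    downUp-split = +-cong downFirst
      (trans (Σ⁻-cong xs (λ ρ → when-+ (capped m (x ∷ ρ)) _ _))
             (trans (Σ⁻-+ _ _ xs) (+-congˡ downLower-upLower)))

    -- Rearranging the pieces: the tail's corner term is exactly the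
    -- shortening of the first row, and if that is impossible no path adds
    -- below the first row and then removes from it.
    balance : ∀ r → (cornerUp + firstUp-lowerDown) + (lowerUp-firstDown + (r + cornerTail))
                  ≈ (when shortenable (K μ + lowerUp-firstDown) + (firstUp-lowerDown + r)) + cornerUp
    balance r = bool-cases shortenable
      (λ short → begin
          (cornerUp + F↑) + (L↑ + (r + cornerTail))
        ≈⟨ +-congˡ (+-congˡ (+-congˡ (when-T (K μ) (≡-trans (≡-sym cornerTail≡shortenable) short)))) ⟩
          (cornerUp + F↑) + (L↑ + (r + K μ))
        ≈⟨ solve 5 (λ a f l t k → (a ⊕ f) ⊕ (l ⊕ (t ⊕ k)) ⊜ ((k ⊕ l) ⊕ (f ⊕ t)) ⊕ a) refl cornerUp F↑ L↑ r (K μ) ⟩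
          ((K μ + L↑) + (F↑ + r)) + cornerUp
        ≈⟨ +-congʳ (+-congʳ (sym (when-T _ short))) ⟩
          (when shortenable (K μ + L↑) + (F↑ + r)) + cornerUp ∎)
      (λ ¬short → begin
          (cornerUp + F↑) + (L↑ + (r + cornerTail))
        ≈⟨ +-congˡ (+-cong (Σ⁺-tightCap x′ xs (λ ν → K (x′ ∷ ν)) capTail ¬short)
                           (+-congˡ (when-F (K μ) (≡-trans (≡-sym cornerTail≡shortenable) ¬short)))) ⟩
          (cornerUp + F↑) + (0# + (r + 0#))
        ≈⟨ solve 3 (λ a f t → (a ⊕ f) ⊕ (∅ ⊕ (t ⊕ ∅)) ⊜ (∅ ⊕ (f ⊕ t)) ⊕ a) refl cornerUp F↑ r ⟩
          (0# + (F↑ + r)) + cornerUp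
        ≈⟨ +-congʳ (+-congʳ (sym (when-F _ ¬short))) ⟩
          (when shortenable (K μ + L↑) + (F↑ + r)) + cornerUp ∎)
      where
      F↑ L↑ : Carrier
      F↑ = firstUp-lowerDown
      L↑ = lowerUp-firstDown

  -- The path-counting identity: from a capped list of positive parts, the
  -- add-then-remove paths outnumber the remove-then-add paths exactly by the
  -- path that adds to and removes from the first row (when the cap allows it).
  upDown-downUp : ∀ m K μ → ZeroBlind K → allPos μ ≡ true → capped m μ ≡ true →
    upDown m K μ ≈ downUp m K μ + when (fits m (suc (head₀ μ))) (K μ)
  upDown-downUp nothing        K [] blind _ _ = trans (+-identityʳ _) (trans (sym (blind (0 ∷ []))) (sym (+-identityˡ _)))
  upDown-downUp (just zero)    K [] blind _ _ = sym (+-identityʳ 0#)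
  upDown-downUp (just (suc b)) K [] blind _ _ = trans (+-identityʳ _) (trans (sym (blind (0 ∷ []))) (sym (+-identityˡ _)))
  upDown-downUp m K (zero ∷ xs)   blind () _
  upDown-downUp m K (suc x′ ∷ xs) blind pos cap = begin
      upDown m K μ
    ≈⟨ upDown-split ⟩
      (cornerUp + firstUp-lowerDown) + (lowerUp-firstDown + upDown (just x) tailK xs)
    ≈⟨ +-congˡ (+-congˡ (upDown-downUp (just x) tailK xs (λ ρ → blind (x ∷ ρ)) pos capTail)) ⟩
      (cornerUp + firstUp-lowerDown) + (lowerUp-firstDown + (downUp (just x) tailK xs + cornerTail))
    ≈⟨ balance _ ⟩
      (when shortenable (K μ + lowerUp-firstDown) + (firstUp-lowerDown + downUp (just x) tailK xs)) + cornerUp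
    ≈⟨ +-congʳ (sym downUp-split) ⟩
      downUp m K μ + cornerUp ∎
    where open FirstRow m K x′ xs cap

module Commutator {c ℓ : Level} (R : CommutativeRing c ℓ) where
  open CommutativeRing R
  open Ops R
  open RowSums R
  open import Relation.Binary.Reasoning.Setoid setoid

  atList : (Partition → Carrier) → List ℕ → Carrier
  atList g ν = maybe′ g 0# (mkPart ν)

  padded : (Partition → Carrier) → List ℕ → Carrier
  padded g ρ = atList g (dropZeros ρ)

  extend : (Partition → Carrier) → List ℕ → Carrier
  extend g = restrict nothing (padded g)

  atList-partition : ∀ g (π : Partition) → atList g (proj₁ π) ≡ g π
  atList-partition g π = cong (maybe′ g 0#) (mkPart-partition π)

  padded-zeroBlind : ∀ g → ZeroBlind (padded g)
  padded-zeroBlind g ρ = reflexive (cong (atList g) (dropZeros-idem ρ))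

  padded-partition : ∀ g (π : Partition) → padded g (proj₁ π) ≡ g π
  padded-partition g π@(μ , p) =
    ≡-trans (cong (atList g) (dropZeros-allPos μ (isPart⇒allPos μ p))) (atList-partition g π)

  atList≈extend : ∀ g ν → allPos ν ≡ true → atList g ν ≈ extend g ν
  atList≈extend g ν pos = mkPart-elim ν (λ mπ → maybe′ g 0# mπ ≈ extend g ν)
    (λ p → sym (trans (when-T _ (isPart⇒capped ν p)) (reflexive (padded-partition g (ν , p)))))
    (λ notPart → sym (when-F _ (≡-trans (≡-sym (isPart≡capped ν pos)) notPart)))

  sum-catMaybes : ∀ (f : Partition → Carrier) ms → sumR (map f (catMaybes ms)) ≈ sumR (map (maybe′ f 0#) ms)
  sum-catMaybes f []            = refl
  sum-catMaybes f (just π ∷ ms) = +-congˡ (sum-catMaybes f ms)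
  sum-catMaybes f (nothing ∷ ms) = trans (sum-catMaybes f ms) (sym (+-identityˡ _))

  sum-mapMaybe-upTo : ∀ (f : Partition → Carrier) (h : List ℕ → Maybe Partition) (k : ℕ → List ℕ) n →
    sumR (map f (mapMaybe h (map k (upTo n)))) ≈ sumR (applyUpTo (λ i → maybe′ f 0# (h (k i))) n)
  sum-mapMaybe-upTo f h k n = trans (sum-catMaybes f (map h (map k (upTo n)))) (reflexive (cong sumR candidates))
    where
    candidates : map (maybe′ f 0#) (map h (map k (upTo n))) ≡ applyUpTo (λ i → maybe′ f 0# (h (k i))) n
    candidates = ≡-trans (cong (λ l → map (maybe′ f 0#) (map h l)) (map-upTo k n))
             (≡-trans (cong (map (maybe′ f 0#)) (map-applyUpTo k h n)) (map-applyUpTo _ (maybe′ f 0#) n))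

  Σ⁺-as-sum : ∀ F μ → sumR (applyUpTo (λ i → F (incAt i μ)) (suc (length μ))) ≈ Σ⁺ F μ
  Σ⁺-as-sum F []       = +-identityʳ _
  Σ⁺-as-sum F (x ∷ xs) = +-congˡ (Σ⁺-as-sum (λ ν → F (x ∷ ν)) xs)

  Σ⁻-as-sum : ∀ F μ → sumR (applyUpTo (λ j → F (decAt j μ)) (length μ)) ≈ Σ⁻ F μ
  Σ⁻-as-sum F []       = refl
  Σ⁻-as-sum F (x ∷ xs) = +-congˡ (Σ⁻-as-sum (λ ν → F (x ∷ ν)) xs)

  removed : (Partition → Carrier) → List ℕ → Carrier
  removed g ρ = maybe′ g 0# (if nonincr ρ then mkPart (dropZeros ρ) else nothing)

  removed≈extend : ∀ g ρ → removed g ρ ≈ extend g ρ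
  removed≈extend g ρ rewrite nonincr≡capped ρ with capped nothing ρ
  ... | true  = refl
  ... | false = refl

  sum-addBox : ∀ g (π : Partition) → sumR (map g (addBox π)) ≈ Σ⁺ (extend g) (proj₁ π)
  sum-addBox g (μ , p) = trans (sum-mapMaybe-upTo g mkPart (λ i → incAt i μ) (suc (length μ)))
    (trans (Σ⁺-as-sum (atList g) μ) (Σ⁺-congPos μ (isPart⇒allPos μ p) (atList≈extend g)))

  sum-removeBox : ∀ g (π : Partition) → sumR (map g (removeBox π)) ≈ Σ⁻ (extend g) (proj₁ π)
  sum-removeBox g (μ , _) = trans (sum-mapMaybe-upTo g _ (λ j → decAt j μ) (length μ))
    (trans (Σ⁻-as-sum (removed g) μ) (Σ⁻-cong μ (removed≈extend g)))

  D-formula : ∀ g (π : Partition) → D g π ≈ Σ⁺ (extend g) (proj₁ π) - g π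
  D-formula g π = +-congʳ (sum-addBox g π)

  D⁻-formula : ∀ g (π : Partition) → D⁻ g π ≈ ℕ→R (size π) * g π - Σ⁻ (extend g) (proj₁ π)
  D⁻-formula g π = +-congˡ (-‿cong (sum-removeBox g π))

  extend-D⁻ : ∀ g ν → allPos ν ≡ true →
    extend (D⁻ g) ν ≈ ℕ→R (sum ν) * extend g ν - when (capped nothing ν) (Σ⁻ (extend g) ν)
  extend-D⁻ g ν pos = trans (sym (atList≈extend (D⁻ g) ν pos)) (mkPart-elim ν
    (λ mπ → maybe′ (D⁻ g) 0# mπ ≈ ℕ→R (sum ν) * extend g ν - when (capped nothing ν) (Σ⁻ (extend g) ν))
    (λ p → trans (D⁻-formula g (ν , p))
                 (+-cong (*-congˡ (trans (reflexive (≡-sym (atList-partition g (ν , p)))) (atList≈extend g ν pos)))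
                         (-‿cong (sym (when-T _ (isPart⇒capped ν p))))))
    (λ notPart → let ¬cap = ≡-trans (≡-sym (isPart≡capped ν pos)) notPart in
      sym (trans (+-cong (trans (*-congˡ (when-F _ ¬cap)) (zeroʳ _)) (-‿cong (when-F _ ¬cap)))
                 (-‿inverseʳ 0#))))

  extend-D : ∀ g ν → extend (D g) ν ≈ when (capped nothing ν) (Σ⁺ (extend g) ν) - extend g ν
  extend-D g ν = bool-cases (capped nothing ν) onCapped onOther
    where
    onCapped : capped nothing ν ≡ true → extend (D g) ν ≈ when (capped nothing ν) (Σ⁺ (extend g) ν) - extend g ν
    onCapped cap = begin
        extend (D g) ν
      ≈⟨ when-T _ cap ⟩
        atList (D g) (dropZeros ν)
      ≡⟨ atList-partition (D g) π ⟩
        D g π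
      ≈⟨ D-formula g π ⟩
        Σ⁺ (extend g) (dropZeros ν) - g π
      ≈⟨ +-cong (sym (Σ⁺-dropZeros nothing (padded g) ν (padded-zeroBlind g) cap))
                (-‿cong (reflexive (≡-sym (atList-partition g π)))) ⟩
        Σ⁺ (extend g) ν - padded g ν
      ≈⟨ sym (+-cong (when-T _ cap) (-‿cong (when-T _ cap))) ⟩
        when (capped nothing ν) (Σ⁺ (extend g) ν) - extend g ν ∎
      where
      π : Partition
      π = dropZeros ν , isPart-dropZeros ν cap
    onOther : capped nothing ν ≡ false → extend (D g) ν ≈ when (capped nothing ν) (Σ⁺ (extend g) ν) - extend g ν
    onOther ¬cap = trans (when-F _ ¬cap)
      (sym (trans (+-cong (when-F _ ¬cap) (-‿cong (when-F _ ¬cap))) (-‿inverseʳ 0#)))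

  -- Expansion of D D⁻ g: adding a box raises the size by one, and the
  -- add-then-remove paths are counted by the path-counting identity.
  DD⁻-expansion : ∀ g (π : Partition) →
    D (D⁻ g) π ≈ ((1# + ℕ→R (size π)) * Σ⁺ (extend g) (proj₁ π) - (downUp nothing (padded g) (proj₁ π) + g π))
                 - (ℕ→R (size π) * g π - Σ⁻ (extend g) (proj₁ π))
  DD⁻-expansion g π@(μ , p) = begin
      D (D⁻ g) π
    ≈⟨ D-formula (D⁻ g) π ⟩
      Σ⁺ (extend (D⁻ g)) μ - D⁻ g π
    ≈⟨ +-cong (Σ⁺-congPos μ pos (extend-D⁻ g)) (-‿cong (D⁻-formula g π)) ⟩
      Σ⁺ (λ ν → ℕ→R (sum ν) * extend g ν - when (capped nothing ν) (Σ⁻ (extend g) ν)) μ - (n * g π - Σ⁻ (extend g) μ)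
    ≈⟨ +-congʳ (Σ⁺-- _ _ μ) ⟩
      (Σ⁺ (λ ν → ℕ→R (sum ν) * extend g ν) μ - upDown nothing (padded g) μ) - (n * g π - Σ⁻ (extend g) μ)
    ≈⟨ +-congʳ (+-cong sizeWeighted (-‿cong paths)) ⟩
      ((1# + n) * Σ⁺ (extend g) μ - (downUp nothing (padded g) μ + g π)) - (n * g π - Σ⁻ (extend g) μ) ∎
    where
    n : Carrier
    n = ℕ→R (size π)
    pos : allPos μ ≡ true
    pos = isPart⇒allPos μ p
    sizeWeighted : Σ⁺ (λ ν → ℕ→R (sum ν) * extend g ν) μ ≈ (1# + n) * Σ⁺ (extend g) μ
    sizeWeighted = trans (Σ⁺-cong μ (λ ν → *-congʳ (sym (+-identityˡ _))))
                         (trans (Σ⁺-sizeWeighted 0# (extend g) μ) (*-congʳ (+-identityˡ _)))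
    paths : upDown nothing (padded g) μ ≈ downUp nothing (padded g) μ + g π
    paths = trans (upDown-downUp nothing (padded g) μ (padded-zeroBlind g) pos (isPart⇒capped μ p))
                  (+-congˡ (reflexive (padded-partition g π)))

  -- Expansion of D⁻ D g: removing a box and reading D g there gives the
  -- remove-then-add paths.
  D⁻D-expansion : ∀ g (π : Partition) →
    D⁻ (D g) π ≈ ℕ→R (size π) * (Σ⁺ (extend g) (proj₁ π) - g π)
                 - (downUp nothing (padded g) (proj₁ π) - Σ⁻ (extend g) (proj₁ π))
  D⁻D-expansion g π = trans (D⁻-formula (D g) π)
    (+-cong (*-congˡ (D-formula g π)) (-‿cong (trans (Σ⁻-cong (proj₁ π) (extend-D g)) (Σ⁻-- _ _ (proj₁ π)))))

  commutator : ∀ (g : Partition → Carrier) (π : Partition) → D (D⁻ g) π - D⁻ (D g) π ≈ D g π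
  commutator g π = begin
      D (D⁻ g) π - D⁻ (D g) π
    ≈⟨ +-cong (DD⁻-expansion g π) (-‿cong (D⁻D-expansion g π)) ⟩
      (((1# + n) * A - (du + g π)) - (n * g π - r)) - (n * (A - g π) - (du - r))
    ≈⟨ commutator-algebra n A du (g π) r ⟩
      A - g π
    ≈⟨ sym (D-formula g π) ⟩
      D g π ∎
    where
    n A r du : Carrier
    n = ℕ→R (size π)
    A = Σ⁺ (extend g) (proj₁ π)
    r = Σ⁻ (extend g) (proj₁ π)
    du = downUp nothing (padded g) (proj₁ π)

  -- For g = 1 and λ = (1) the commutator is D g λ = 2 − 1 = 1 ≠ 0.
  noncommuting : ¬ (1# ≈ 0#) →
    ∃ λ (g : Partition → Carrier) → ∃ λ (π : Partition) → ¬ (D (D⁻ g) π ≈ D⁻ (D g) π)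
  noncommuting 1≉0 = one , single , λ commute → 1≉0 (begin
      1#
    ≈⟨ sym two-minus-one ⟩
      D one single
    ≈⟨ sym (commutator one single) ⟩
      D (D⁻ one) single - D⁻ (D one) single
    ≈⟨ +-congʳ commute ⟩
      D⁻ (D one) single - D⁻ (D one) single
    ≈⟨ -‿inverseʳ _ ⟩
      0# ∎)
    where
    one : Partition → Carrier
    one _ = 1#
    single : Partition
    single = 1 ∷ [] , _
    -- (1) has the two neighbours (2) and (1, 1).
    two-minus-one : (1# + (1# + 0#)) - 1# ≈ 1#
    two-minus-one = trans (+-congʳ (+-congˡ (+-identityʳ 1#)))
      (trans (+-assoc 1# 1# (- 1#)) (trans (+-congˡ (-‿inverseʳ 1#)) (+-identityʳ 1#)))

lemma2p8 : {c ℓ : Level} (R : CommutativeRing c ℓ) →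
    let open CommutativeRing R
        open Ops R
    in (∀ (g : Partition → Carrier) (λ′ : Partition) →
          D (D⁻ g) λ′ - D⁻ (D g) λ′ ≈ D g λ′)
       × (¬ (1# ≈ 0#) →
          ∃ λ (g : Partition → Carrier) → ∃ λ (λ′ : Partition) →
            ¬ (D (D⁻ g) λ′ ≈ D⁻ (D g) λ′))
lemma2p8 R = Commutator.commutator R , Commutator.noncommuting R
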